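{- Let $A$ be a partially ordered set with top $\top$ and bottom $\bot$, and let $\mathcal C$ be a class of games over $A$ that is closed under equivalence $\equiv$ and under the four primitive gadgets: $G\in\mathcal C\Rightarrow\{\top\mid G\}\in\mathcal C$; $G\in\mathcal C\Rightarrow\{G\mid\bot\}\in\mathcal C$; $G,H\in\mathcal C\Rightarrow\{\{\top\mid G\},\{\top\mid H\}\mid\{G\mid\bot\},\{H\mid\bot\}\}\in\mathcal C$; $G,H\in\mathcal C\Rightarrow\{G,\{\top\mid H\}\mid\{G\mid\bot\},H\}\in\mathcal C$. If $G,H\in\mathcal C$ and the game $K=\{G\mid H\}$ is locally monotone, then $K\in\mathcal C$.
   Context: Games over $A$: for each $a\in A$, $[a]$ is an atomic game with no options; if $L,R$ are non-empty sets of games, $\{L\mid R\}$ is a composite game with left options $L$ and right options $R$. Inside braces an atom $x$ stands for $[x]$. $\le$ and $\lhd$ by mutual recursion: $G\le H$ iff every left option $G^L$ satisfies $G^L\lhd H$, every right option $H^R$ satisfies $G\lhd H^R$, and if $G$ or $H$ is atomic then $G\lhd H$; $G\lhd H$ iff some $G^R\le H$, or $G\le$ some $H^L$, or $G=[a],H=[b]$ with $a\le b$. $G\equiv H$ means $G\le H$ and $H\le G$. A left option $K^L$ of a composite game $K$ is good if $K\le K^L$; a right option $K^R$ is good if $K^R\le K$. $K$ is locally monotone if all of its left and right options are good. -}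

module Defs where

open import Level using (Level; _⊔_; suc; 0ℓ)
open import Relation.Binary.Bundles using (Poset)
open import Data.Product using (Σ; _×_; _,_)
open import Data.Sum using (_⊎_)
open import Data.Unit using (⊤; tt)
open import Data.Empty using (⊥)
open import Data.Bool using (Bool; true; false)

-- Games over the carrier of a poset P.
-- A composite game has a non-empty family of left options (indexed by I,
-- with a witness of non-emptiness) and a non-empty family of right options.
module Games {c ℓ₁ ℓ₂ : Level} (P : Poset c ℓ₁ ℓ₂) where
  open Poset P renaming (Carrier to A; _≤_ to _≤A_)

  data Game : Set (suc 0ℓ ⊔ c) where
    atom : A → Game
    comp : (I : Set) → I → (I → Game) → (J : Set) → J → (J → Game) → Game

  infix 4 _≤G_ _◁_ _≡G_

  mutual
    _≤G_ : Game → Game → Set (c ⊔ ℓ₂)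
    atom a ≤G atom b = atom a ◁ atom b
    atom a ≤G comp I i₀ L J j₀ R =
      ((j : J) → atom a ◁ R j) × (atom a ◁ comp I i₀ L J j₀ R)
    comp I i₀ L J j₀ R ≤G atom b =
      ((i : I) → L i ◁ atom b) × (comp I i₀ L J j₀ R ◁ atom b)
    comp I i₀ L J j₀ R ≤G comp I' i₀' L' J' j₀' R' =
      ((i : I) → L i ◁ comp I' i₀' L' J' j₀' R')
      × ((j : J') → comp I i₀ L J j₀ R ◁ R' j)

    _◁_ : Game → Game → Set (c ⊔ ℓ₂)
    atom a ◁ atom b = Lift-≤ a b
    atom a ◁ comp I i₀ L J j₀ R = Σ I (λ i → atom a ≤G L i)
    comp I i₀ L J j₀ R ◁ atom b = Σ J (λ j → R j ≤G atom b)
    comp I i₀ L J j₀ R ◁ comp I' i₀' L' J' j₀' R' =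
      Σ J (λ j → R j ≤G comp I' i₀' L' J' j₀' R')
      ⊎ Σ I' (λ i → comp I i₀ L J j₀ R ≤G L' i)

    Lift-≤ : A → A → Set (c ⊔ ℓ₂)
    Lift-≤ a b = Level.Lift (c ⊔ ℓ₂) (a ≤A b)

  _≡G_ : Game → Game → Set (c ⊔ ℓ₂)
  G ≡G H = (G ≤G H) × (H ≤G G)

  ⟨_∣_⟩ : Game → Game → Game
  ⟨ G ∣ H ⟩ = comp ⊤ tt (λ _ → G) ⊤ tt (λ _ → H)

  pair : Game → Game → Bool → Game
  pair G H true = G
  pair G H false = H

  game₂₂ : Game → Game → Game → Game → Game
  game₂₂ G₁ G₂ H₁ H₂ = comp Bool true (pair G₁ G₂) Bool true (pair H₁ H₂)

  LocallyMonotone : Game → Set (c ⊔ ℓ₂)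
  LocallyMonotone (atom a) = Level.Lift _ ⊥
  LocallyMonotone (comp I i₀ L J j₀ R) =
    ((i : I) → comp I i₀ L J j₀ R ≤G L i) × ((j : J) → R j ≤G comp I i₀ L J j₀ R)

  record Closed {p : Level} (top bot : A) (C : Game → Set p)
         : Set (suc 0ℓ ⊔ c ⊔ ℓ₂ ⊔ p) where
    field
      closed-≡  : ∀ G H → G ≡G H → C G → C H
      gadget₁   : ∀ G → C G → C ⟨ atom top ∣ G ⟩
      gadget₂   : ∀ G → C G → C ⟨ G ∣ atom bot ⟩
      gadget₃   : ∀ G H → C G → C H →
                  C (game₂₂ ⟨ atom top ∣ G ⟩ ⟨ atom top ∣ H ⟩ ⟨ G ∣ atom bot ⟩ ⟨ H ∣ atom bot ⟩)
      gadget₄   : ∀ G H → C G → C H →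
                  C (game₂₂ G ⟨ atom top ∣ H ⟩ ⟨ G ∣ atom bot ⟩ H)

-- The fourth gadget applied to G and H is already equivalent to K = {G | H}
-- whenever K is locally monotone: the extra left option {⊤ | H} of the gadget
-- is dominated through its right option H ≤ K, and the extra right option
-- {G | ⊥} through its left option G ≥ K.
module Submission where

open import Defs
open import Level using (Level)
open import Relation.Binary.Bundles using (Poset)
open import Relation.Binary.Definitions using (Maximum; Minimum)
open import Data.Product using (_,_)
open import Data.Sum using (inj₁; inj₂)
open import Data.Unit using (tt)
open import Data.Bool using (Bool; true; false)

module _ {c ℓ₁ ℓ₂ : Level} (P : Poset c ℓ₁ ℓ₂) where
  open Poset P using (refl)
  open Games P

  ≤⇒◁-leftOption : ∀ G I i₀ L J j₀ R (i : I) → G ≤G L i → G ◁ comp I i₀ L J j₀ R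
  ≤⇒◁-leftOption (atom a)           I i₀ L J j₀ R i G≤Lᵢ = i , G≤Lᵢ
  ≤⇒◁-leftOption (comp _ _ _ _ _ _) I i₀ L J j₀ R i G≤Lᵢ = inj₂ (i , G≤Lᵢ)

  ≤⇒◁-rightOption : ∀ H I i₀ L J j₀ R (j : J) → R j ≤G H → comp I i₀ L J j₀ R ◁ H
  ≤⇒◁-rightOption (atom a)           I i₀ L J j₀ R j Rⱼ≤H = j , Rⱼ≤H
  ≤⇒◁-rightOption (comp _ _ _ _ _ _) I i₀ L J j₀ R j Rⱼ≤H = inj₁ (j , Rⱼ≤H)

  ≤G-refl : ∀ G → G ≤G G
  ≤G-refl (atom a)             = Level.lift refl
  ≤G-refl (comp I i₀ L J j₀ R) =
    (λ i → ≤⇒◁-leftOption (L i) I i₀ L J j₀ R i (≤G-refl (L i))) ,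
    (λ j → ≤⇒◁-rightOption (R j) I i₀ L J j₀ R j (≤G-refl (R j)))

  gadget₄-shape-≡G : ∀ G H X Y → ⟨ G ∣ H ⟩ ≤G G → H ≤G ⟨ G ∣ H ⟩ →
                     game₂₂ G ⟨ X ∣ H ⟩ ⟨ G ∣ Y ⟩ H ≡G ⟨ G ∣ H ⟩
  gadget₄-shape-≡G G H X Y K≤G H≤K = gadget≤K , K≤gadget
    where
    K = ⟨ G ∣ H ⟩
    lefts  = pair G ⟨ X ∣ H ⟩
    rights = pair ⟨ G ∣ Y ⟩ H

    left◁K : ∀ b → lefts b ◁ K
    left◁K true  = ≤⇒◁-leftOption G _ tt (λ _ → G) _ tt (λ _ → H) tt (≤G-refl G)
    left◁K false = inj₁ (tt , H≤K)

    K◁right : ∀ b → K ◁ rights b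
    K◁right true  = inj₂ (tt , K≤G)
    K◁right false = ≤⇒◁-rightOption H _ tt (λ _ → G) _ tt (λ _ → H) tt (≤G-refl H)

    gadget≤K : game₂₂ G ⟨ X ∣ H ⟩ ⟨ G ∣ Y ⟩ H ≤G K
    gadget≤K = left◁K , λ _ → ≤⇒◁-rightOption H Bool true lefts Bool true rights false (≤G-refl H)

    K≤gadget : K ≤G game₂₂ G ⟨ X ∣ H ⟩ ⟨ G ∣ Y ⟩ H
    K≤gadget = (λ _ → ≤⇒◁-leftOption G Bool true lefts Bool true rights true (≤G-refl G)) , K◁right

lemma3p7 : ∀ {c ℓ₁ ℓ₂ p : Level} (P : Poset c ℓ₁ ℓ₂)
    (top bot : Poset.Carrier P) →
    Maximum (Poset._≤_ P) top → Minimum (Poset._≤_ P) bot →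
    (C : Games.Game P → Set p) → Games.Closed P top bot C →
    (G H : Games.Game P) → C G → C H →
    Games.LocallyMonotone P (Games.⟨_∣_⟩ P G H) →
    C (Games.⟨_∣_⟩ P G H)
lemma3p7 P top bot _ _ C closed G H CG CH (K≤G , H≤K) =
  closed-≡ _ _ (gadget₄-shape-≡G P G H (Games.atom top) (Games.atom bot) (K≤G tt) (H≤K tt))
           (gadget₄ G H CG CH)
  where open Games.Closed closed
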